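{- Let $m>1$ be an integer and $\mathcal{F}(\mathbb{B}(2m),m)$ the sequence defined in the context. Let $j$ be a positive integer and put $c=\left\lceil\tfrac{2m}{j}\right\rceil$, $c'=\left\lceil\tfrac{2(m+1)}{j}\right\rceil$. All fractions below are understood with numerator and denominator coprime. (i) If $\tfrac{2}{j+2}\in\mathcal{F}(\mathbb{B}(2m),m)$ and $\tfrac{2}{j+2}<\tfrac12$, then \[ \begin{cases} (c-1)\Big/\tfrac{(j+2)(c-1)+1}{2}, & c \text{ even},\\ (c-2)\Big/\tfrac{(j+2)(c-2)+1}{2}, & c \text{ odd},\end{cases} \] immediately precedes $\tfrac{2}{j+2}$, and \[ \begin{cases} (c'-1)\Big/\tfrac{(j+2)(c'-1)-1}{2}, & c' \text{ even},\\ (c'-2)\Big/\tfrac{(j+2)(c'-2)-1}{2}, & c' \text{ odd},\end{cases} \] immediately succeeds $\tfrac{2}{j+2}$ in $\mathcal{F}(\mathbb{B}(2m),m)$. (ii) If $\tfrac{j-2}{2(j-1)}\in\mathcal{F}(\mathbb{B}(2m),m)$ and $\tfrac{j-2}{2(j-1)}<\tfrac12$, then \[ \begin{cases} \tfrac{(j-2)(c'-1)-1}{2}\Big/\big((j-1)(c'-1)-1\big), & c' \text{ even},\\ \tfrac{(j-2)(c'-2)-1}{2}\Big/\big((j-1)(c'-2)-1\big), & c' \text{ odd},\end{cases} \] immediately precedes $\tfrac{j-2}{2(j-1)}$, and \[ \begin{cases} \tfrac{(j-2)(c-1)+1}{2}\Big/\big((j-1)(c-1)+1\big), & c \text{ even},\\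 \tfrac{(j-2)(c-2)+1}{2}\Big/\big((j-1)(c-2)+1\big), & c \text{ odd},\end{cases} \] immediately succeeds $\tfrac{j-2}{2(j-1)}$ in $\mathcal{F}(\mathbb{B}(2m),m)$. (iii) If $\tfrac{j}{2(j-1)}\in\mathcal{F}(\mathbb{B}(2m),m)$ and $\tfrac12<\tfrac{j}{2(j-1)}$, then \[ \begin{cases} \tfrac{j(c-1)+1}{2}\Big/\big((j-1)(c-1)+1\big), & c \text{ even},\\ \tfrac{j(c-2)+1}{2}\Big/\big((j-1)(c-2)+1\big), & c \text{ odd},\end{cases} \] immediately precedes $\tfrac{j}{2(j-1)}$, and \[ \begin{cases} \tfrac{j(c'-1)-1}{2}\Big/\big((j-1)(c'-1)-1\big), & c' \text{ even},\\ \tfrac{j(c'-2)-1}{2}\Big/\big((j-1)(c'-2)-1\big), & c' \text{ odd},\end{cases} \] immediately succeeds $\tfrac{j}{2(j-1)}$ in $\mathcal{F}(\mathbb{B}(2m),m)$. (iv) If $\tfrac{j}{j+2}\in\mathcal{F}(\mathbb{B}(2m),m)$ and $\tfrac12<\tfrac{j}{j+2}$, then \[ \begin{cases} \tfrac{j(c'-1)-1}{2}\Big/\tfrac{(j+2)(c'-1)-1}{2}, & c' \text{ even},\\ \tfrac{j(c'-2)-1}{2}\Big/\tfrac{(j+2)(c'-2)-1}{2}, & c' \text{ odd},\end{cases} \] immediately precedes $\tfrac{j}{j+2}$, and \[ \begin{cases} \tfrac{j(c-1)+1}{2}\Big/\tfrac{(j+2)(c-1)+1}{2}, & c \text{ even},\\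 \tfrac{j(c-2)+1}{2}\Big/\tfrac{(j+2)(c-2)+1}{2}, & c \text{ odd},\end{cases} \] immediately succeeds $\tfrac{j}{j+2}$ in $\mathcal{F}(\mathbb{B}(2m),m)$.
   Context: For an integer $n\ge1$, the Farey sequence $\mathcal{F}_n$ of order $n$ is the ascending sequence of all rational numbers $\tfrac{h}{k}$ written in lowest terms ($\gcd(h,k)=1$) with $0\le \tfrac hk\le 1$ and $1\le k\le n$. For an integer $m>1$, $\mathcal{F}(\mathbb{B}(2m),m)$ denotes the subsequence of $\mathcal{F}_{2m}$ consisting of those fractions $\tfrac hk\in\mathcal{F}_{2m}$ with $k-m\le h\le m$. "Precedes"/"succeeds" mean being the element immediately before/after in this sequence. The notation $x\big/y$ denotes the fraction with numerator $x$ and denominator $y$. -}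

module Defs where

open import Data.Nat using (ℕ; zero; suc; _+_; _*_; _∸_; _≤_; _<_; NonZero; ⌊_/2⌋)
open import Data.Nat.DivMod using (_/_)
open import Data.Nat.Divisibility using (_∣_)
open import Data.Nat.Coprimality using (Coprime)
open import Data.Product using (_×_)
open import Relation.Nullary using (¬_)

⌈_/_⌉ : (a b : ℕ) → .{{NonZero b}} → ℕ
⌈ a / b ⌉ = (a + (b ∸ 1)) / b

-- h/k (numerator h, denominator k) is an element of F(B(2m), m):
-- gcd(h,k)=1, 0 ≤ h/k ≤ 1, 1 ≤ k ≤ 2m, k - m ≤ h ≤ m
InF : (m h k : ℕ) → Set
InF m h k = Coprime h k × h ≤ k × 1 ≤ k × k ≤ 2 * m × k ≤ m + h × h ≤ m

FLess : (a b x y : ℕ) → Set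
FLess a b x y = a * y < x * b

Precedes : (m a b x y : ℕ) → Set
Precedes m a b x y =
  InF m a b × InF m x y × FLess a b x y ×
  (∀ h k → InF m h k → ¬ (FLess a b h k × FLess h k x y))

Succeeds : (m s t x y : ℕ) → Set
Succeeds m s t x y = Precedes m x y s t

ByParity : ℕ → (ℕ → Set) → Set
ByParity c P = (2 ∣ c → P (c ∸ 1)) × (¬ (2 ∣ c) → P (c ∸ 2))

-- Write j = 3 + 2s (a reduced fraction of the given shape forces j odd and j ≥ 3) and let
-- d = 1 + 2t be the odd one of c - 1, c - 2. Each claimed neighbour a/b of the given
-- fraction x/y satisfies x b - a y = 1, so by Cramer's rule every fraction h/k strictly
-- between them is h/k = (a (p+1) + x (q+1)) / (b (p+1) + y (q+1)) with p, q ≥ 0. Hence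
-- h ≥ a + x and k - h ≥ (b - a) + (y - x). Membership in F(B(2m), m) requires h ≤ m and
-- k - h ≤ m, so nothing lies between a/b and x/y as soon as the mediant (a + x)/(b + y)
-- violates one of these two bounds. The ceiling defining c pins m between two quadratic
-- polynomials in s and t, which is exactly what makes the neighbour satisfy both bounds
-- and the mediant violate one.
module Submission where

open import Defs
open import Data.Nat using (ℕ; zero; suc; _+_; _*_; _∸_; _≤_; _<_; z≤n; s≤s; NonZero; ⌊_/2⌋; _<?_)
open import Data.Nat.Properties
open import Data.Nat.Divisibility
  using (_∣_; divides; divides-refl; ∣-refl; ∣-trans; m∣m*n; n∣m*n; ∣m+n∣m⇒∣n; ∣m∣n⇒∣m+n; ∣1⇒≡1)
open import Data.Nat.DivMod using (m≡m%n+[m/n]*n; m%n<n)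
open import Data.Nat.Coprimality using (Coprime)
open import Data.Nat.Tactic.RingSolver using (solve)
open import Data.List using (_∷_; [])
open import Data.Product using (_×_; _,_; proj₁; proj₂; ∃; ∃₂)
open import Data.Sum using (_⊎_; inj₁; inj₂)
open import Relation.Nullary using (¬_; contradiction)
open import Relation.Nullary.Decidable using (from-no)
open import Relation.Binary.PropositionalEquality

InRange : (m h k : ℕ) → Set
InRange m h k = h ≤ k × 1 ≤ k × k ≤ 2 * m × k ≤ m + h × h ≤ m

n≡m+o⇒m≤n : ∀ {m n} o → n ≡ m + o → m ≤ n
n≡m+o⇒m≤n {m} o refl = m≤m+n m o

m<n⇒∃[o]n≡1+m+o : ∀ {m n} → m < n → ∃ λ o → n ≡ suc (m + o)
m<n⇒∃[o]n≡1+m+o m<n = let o , eq = m≤n⇒∃[o]m+o≡n m<n in o , sym eq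

unimodular⇒coprimeˡ : ∀ {a b x y} → x * b ≡ suc (a * y) → Coprime a b
unimodular⇒coprimeˡ {a} {b} {x} {y} det {i} (i∣a , i∣b) =
  ∣1⇒≡1 (∣m+n∣m⇒∣n i∣ay+1 (∣-trans i∣a (m∣m*n y)))
  where
  i∣ay+1 : i ∣ a * y + 1
  i∣ay+1 = subst (i ∣_) (trans det (+-comm 1 (a * y))) (∣-trans i∣b (n∣m*n x))

unimodular⇒coprimeʳ : ∀ {a b x y} → x * b ≡ suc (a * y) → Coprime x y
unimodular⇒coprimeʳ {a} {b} {x} {y} det {i} (i∣x , i∣y) =
  ∣1⇒≡1 (∣m+n∣m⇒∣n i∣ay+1 (∣-trans i∣y (n∣m*n a)))
  where
  i∣ay+1 : i ∣ a * y + 1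
  i∣ay+1 = subst (i ∣_) (trans det (+-comm 1 (a * y))) (∣-trans i∣x (m∣m*n b))

mediant-decomposition : ∀ {a b x y h k} → x * b ≡ suc (a * y) → FLess a b h k → FLess h k x y →
  ∃₂ λ p q → h ≡ a * suc p + x * suc q × k ≡ b * suc p + y * suc q
mediant-decomposition {a} {b} {x} {y} {h} {k} det ab<hk hk<xy
  with q , hb ← m<n⇒∃[o]n≡1+m+o ab<hk | p , xk ← m<n⇒∃[o]n≡1+m+o hk<xy = p , q , h≡ , k≡
  where
  open ≡-Reasoning
  h≡ : h ≡ a * suc p + x * suc q
  h≡ = +-cancelˡ-≡ (a * y * h) _ _ (begin
    a * y * h + h                   ≡⟨ solve (a ∷ y ∷ h ∷ []) ⟩
    suc (a * y) * h                 ≡⟨ cong (_* h) det ⟨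
    x * b * h                       ≡⟨ solve (x ∷ b ∷ h ∷ []) ⟩
    x * (h * b)                     ≡⟨ cong (x *_) hb ⟩
    x * suc (a * k + q)             ≡⟨ solve (x ∷ a ∷ k ∷ q ∷ []) ⟩
    a * (x * k) + x * suc q         ≡⟨ cong (λ z → a * z + x * suc q) xk ⟩
    a * suc (h * y + p) + x * suc q ≡⟨ solve (a ∷ h ∷ y ∷ p ∷ x ∷ q ∷ []) ⟩
    a * y * h + (a * suc p + x * suc q) ∎)
  k≡ : k ≡ b * suc p + y * suc q
  k≡ = +-cancelˡ-≡ (a * y * k) _ _ (begin
    a * y * k + k                   ≡⟨ solve (a ∷ y ∷ k ∷ []) ⟩
    suc (a * y) * k                 ≡⟨ cong (_* k) det ⟨
    x * b * k                       ≡⟨ solve (x ∷ b ∷ k ∷ []) ⟩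
    b * (x * k)                     ≡⟨ cong (b *_) xk ⟩
    b * suc (h * y + p)             ≡⟨ solve (b ∷ h ∷ y ∷ p ∷ []) ⟩
    y * (h * b) + b * suc p         ≡⟨ cong (λ z → y * z + b * suc p) hb ⟩
    y * suc (a * k + q) + b * suc p ≡⟨ solve (y ∷ a ∷ k ∷ q ∷ b ∷ p ∷ []) ⟩
    a * y * k + (b * suc p + y * suc q) ∎)

combination-numerator-≥ : ∀ a x p q → a + x ≤ a * suc p + x * suc q
combination-numerator-≥ a x p q = n≡m+o⇒m≤n (a * p + x * q) (solve (a ∷ x ∷ p ∷ q ∷ []))

combination-gap-≥ : ∀ {a b x y} p q → a ≤ b → x ≤ y →
  (a * suc p + x * suc q) + (b + y) ≤ (b * suc p + y * suc q) + (a + x)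
combination-gap-≥ {a} {b} {x} {y} p q a≤b x≤y = begin
  (a * suc p + x * suc q) + (b + y)   ≡⟨ solve (a ∷ b ∷ x ∷ y ∷ p ∷ q ∷ []) ⟩
  (a + x + (b + y)) + (a * p + x * q) ≤⟨ +-monoʳ-≤ (a + x + (b + y)) (+-mono-≤ (*-monoˡ-≤ p a≤b) (*-monoˡ-≤ q x≤y)) ⟩
  (a + x + (b + y)) + (b * p + y * q) ≡⟨ solve (a ∷ b ∷ x ∷ y ∷ p ∷ q ∷ []) ⟩
  (b * suc p + y * suc q) + (a + x)   ∎
  where open ≤-Reasoning

nothing-between : ∀ {m a b x y} → x * b ≡ suc (a * y) → a ≤ b → x ≤ y →
  m < a + x ⊎ m + (a + x) < b + y → ∀ h k → InF m h k → ¬ (FLess a b h k × FLess h k x y)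
nothing-between {m} {a} {b} {x} {y} det a≤b x≤y outside h k (_ , _ , _ , _ , k≤m+h , h≤m) (ab<hk , hk<xy)
  with p , q , refl , refl ← mediant-decomposition {a} {b} {x} {y} {h} {k} det ab<hk hk<xy
  with outside
... | inj₁ m<a+x = <⇒≱ m<a+x (≤-trans (combination-numerator-≥ a x p q) h≤m)
... | inj₂ m+a+x<b+y = <-irrefl refl (begin-strict
  h + (m + (a + x)) <⟨ +-monoʳ-< h m+a+x<b+y ⟩
  h + (b + y)       ≤⟨ combination-gap-≥ p q a≤b x≤y ⟩
  k + (a + x)       ≤⟨ +-monoˡ-≤ (a + x) k≤m+h ⟩
  m + h + (a + x)   ≡⟨ trans (cong (_+ (a + x)) (+-comm m h)) (+-assoc h m (a + x)) ⟩
  h + (m + (a + x)) ∎)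
  where open ≤-Reasoning

adjacent-if-mediant-outside : ∀ {m a b x y} → x * b ≡ suc (a * y) → InRange m a b → InRange m x y →
  m < a + x ⊎ m + (a + x) < b + y → Precedes m a b x y
adjacent-if-mediant-outside {a = a} {b} {x} {y} det a/b x/y outside =
  (unimodular⇒coprimeˡ {x = x} {y} det , a/b) , (unimodular⇒coprimeʳ {a} {b} det , x/y) ,
  ≤-reflexive (sym det) ,
  nothing-between det (proj₁ a/b) (proj₁ x/y) outside

⌊E/2⌋≡n : ∀ {E} n → E ≡ n + n → ⌊ E /2⌋ ≡ n
⌊E/2⌋≡n n refl = sym (n≡⌊n+n/2⌋ n)

⌊E∸1/2⌋≡n : ∀ {E} n → E ≡ suc (n + n) → ⌊ E ∸ 1 /2⌋ ≡ n
⌊E∸1/2⌋≡n n eq = ⌊E/2⌋≡n n (cong (_∸ 1) eq)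

inRange-intro : ∀ {m M} h k → M ≤ m → 1 ≤ k → h ≤ k → h ≤ M → k ≤ M + h → InRange m h k
inRange-intro {m} {M} h k M≤m 1≤k h≤k h≤M k≤M+h =
  h≤k , 1≤k , k≤2m , ≤-trans k≤M+h (+-monoˡ-≤ h M≤m) , ≤-trans h≤M M≤m
  where
  k≤2m : k ≤ 2 * m
  k≤2m = ≤-trans k≤M+h (≤-trans (+-mono-≤ M≤m (≤-trans h≤M M≤m)) (≤-reflexive (cong (m +_) (sym (+-identityʳ m)))))

quotient-bounds : ∀ {N j c r} → N + j ≡ r + c * suc j → r ≤ j → 0 < N →
  suc j * (c ∸ 1) < N × N ≤ suc j * c
quotient-bounds {N} {j} {c} {r} division r≤j 0<N = lower c division , upper
  where
  open ≤-Reasoning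
  upper : N ≤ suc j * c
  upper = +-cancelʳ-≤ j N (suc j * c) (begin
    N + j         ≡⟨ division ⟩
    r + c * suc j ≤⟨ +-monoˡ-≤ (c * suc j) r≤j ⟩
    j + c * suc j ≡⟨ solve (j ∷ c ∷ []) ⟩
    suc j * c + j ∎)
  lower : ∀ c → N + j ≡ r + c * suc j → suc j * (c ∸ 1) < N
  lower zero    _   = subst (_< N) (sym (*-zeroʳ j)) 0<N
  lower (suc c) div = +-cancelʳ-≤ j (suc (suc j * c)) N (begin
    suc (suc j * c) + j ≡⟨ solve (j ∷ c ∷ []) ⟩
    suc c * suc j       ≤⟨ m≤n+m (suc c * suc j) r ⟩
    r + suc c * suc j   ≡⟨ div ⟨
    N + j               ∎)

⌈N/j⌉-bounds : ∀ N j .{{_ : NonZero j}} → 0 < N → j * (⌈ N / j ⌉ ∸ 1) < N × N ≤ j * ⌈ N / j ⌉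
⌈N/j⌉-bounds N (suc j) = quotient-bounds (m≡m%n+[m/n]*n (N + j) (suc j)) (m<1+n⇒m≤n (m%n<n (N + j) (suc j)))

parity : ∀ n → (∃ λ t → n ≡ 2 * t) ⊎ (∃ λ t → n ≡ 1 + 2 * t)
parity zero = inj₁ (0 , refl)
parity (suc n) with parity n
... | inj₁ (t , refl) = inj₂ (t , refl)
... | inj₂ (t , refl) = inj₁ (suc t , sym (*-suc 2 t))

2∣2+2t : ∀ t → 2 ∣ 2 + 2 * t
2∣2+2t t = ∣m∣n⇒∣m+n ∣-refl (m∣m*n t)

2∤3+2t : ∀ t → ¬ 2 ∣ 3 + 2 * t
2∤3+2t t (divides q eq) = even≢odd q (suc t) (begin
  2 * q             ≡⟨ *-comm 2 q ⟩
  q * 2             ≡⟨ eq ⟨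
  3 + 2 * t         ≡⟨ cong suc (*-suc 2 t) ⟨
  suc (2 * suc t)   ∎)
  where open ≡-Reasoning

byParity-window : ∀ {P : ℕ → Set} j N c → 2 ≤ c → j * (c ∸ 1) < N → N ≤ j * c →
  (∀ t → j * (1 + 2 * t) < N → N ≤ j * (3 + 2 * t) → P (1 + 2 * t)) → ByParity c P
byParity-window j N 1 (s≤s ()) lo hi odd-case
byParity-window j N (suc (suc c)) _ lo hi odd-case with parity c
... | inj₁ (t , refl) =
  (λ _ → odd-case t lo (≤-trans hi (*-monoʳ-≤ j (n≤1+n (2 + 2 * t))))) ,
  (λ 2∤c → contradiction (2∣2+2t t) 2∤c)
... | inj₂ (t , refl) =
  (λ 2∣c → contradiction 2∣c (2∤3+2t t)) ,
  (λ _ → odd-case t (≤-<-trans (*-monoʳ-≤ j (n≤1+n (1 + 2 * t))) lo) hi)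

byParity-⌈N/j⌉ : ∀ {P : ℕ → Set} N j .{{_ : NonZero j}} → j < N →
  (∀ t → j * (1 + 2 * t) < N → N ≤ j * (3 + 2 * t) → P (1 + 2 * t)) → ByParity ⌈ N / j ⌉ P
byParity-⌈N/j⌉ {P} N j j<N odd-case =
  let lo , hi = ⌈N/j⌉-bounds N j (≤-<-trans z≤n j<N)
      2≤c = *-cancelˡ-< j 1 ⌈ N / j ⌉ (<-≤-trans (subst (_< N) (sym (*-identityʳ j)) j<N) hi)
  in byParity-window {P} j N ⌈ N / j ⌉ 2≤c lo hi odd-case

odd⇒3+2* : ∀ {j} → j ≢ 1 → ¬ 2 ∣ j → ∃ λ s → j ≡ 3 + 2 * s
odd⇒3+2* {j} j≢1 2∤j with parity j
... | inj₁ (t , refl)     = contradiction (m∣m*n t) 2∤j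
... | inj₂ (zero , refl)  = contradiction refl j≢1
... | inj₂ (suc s , refl) = s , cong suc (*-suc 2 s)

-- For j = 3 + 2s and d = 1 + 2t, j d = 2L + 1 and j (d + 2) = 2U + 1 with L, U the bounds below.
odd-window : ∀ s t n → (3 + 2 * s) * (1 + 2 * t) < 2 * n → 2 * n ≤ (3 + 2 * s) * (3 + 2 * t) →
  2 * s * t + s + 3 * t + 1 < n × n ≤ 2 * s * t + 3 * s + 3 * t + 4
odd-window s t n lo hi = *-cancelˡ-≤ 2 (≤-trans (≤-reflexive below) lo) ,
  ≤-pred (*-cancelˡ-< 2 n _ (≤-trans (s≤s hi) (≤-reflexive above)))
  where
  below : 2 * suc (2 * s * t + s + 3 * t + 1) ≡ suc ((3 + 2 * s) * (1 + 2 * t))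
  below = solve (s ∷ t ∷ [])
  above : suc ((3 + 2 * s) * (3 + 2 * t)) ≡ 2 * suc (2 * s * t + 3 * s + 3 * t + 4)
  above = solve (s ∷ t ∷ [])

m≤n⇒m<2*n : ∀ {m n} → 0 < m → m ≤ n → m < 2 * n
m≤n⇒m<2*n {m} {n} 0<m m≤n =
  ≤-<-trans m≤n (subst (n <_) (cong (n +_) (sym (+-identityʳ n))) (m<m+n n (<-≤-trans 0<m m≤n)))

-- The neighbour is requested at a variable d ≡ 1 + 2t so that P is found by pattern unification.
byParity-⌈2m/j⌉ : ∀ {P : ℕ → Set} m s →
  (∀ t d → d ≡ 1 + 2 * t → 2 * s * t + s + 3 * t + 1 < m → m ≤ 2 * s * t + 3 * s + 3 * t + 4 → P d) →
  3 + 2 * s ≤ m → ByParity ⌈ 2 * m / 3 + 2 * s ⌉ P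
byParity-⌈2m/j⌉ {P} m s neighbour j≤m =
  byParity-⌈N/j⌉ {P} (2 * m) (3 + 2 * s) (m≤n⇒m<2*n (s≤s z≤n) j≤m) λ t lo hi →
    let L<m , m≤U = odd-window s t m lo hi in neighbour t (1 + 2 * t) refl L<m m≤U

byParity-⌈2[m+1]/j⌉ : ∀ {P : ℕ → Set} m s →
  (∀ t d → d ≡ 1 + 2 * t → 2 * s * t + s + 3 * t + 1 ≤ m → m < 2 * s * t + 3 * s + 3 * t + 4 → P d) →
  3 + 2 * s ≤ m → ByParity ⌈ 2 * (m + 1) / 3 + 2 * s ⌉ P
byParity-⌈2[m+1]/j⌉ {P} m s neighbour j≤m =
  byParity-⌈N/j⌉ {P} (2 * (m + 1)) (3 + 2 * s) (m≤n⇒m<2*n (s≤s z≤n) (m≤n⇒m≤n+o 1 j≤m)) λ t lo hi →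
    let L<m+1 , m+1≤U = odd-window s t (m + 1) lo hi
    in neighbour t (1 + 2 * t) refl (≤-pred (≤-trans L<m+1 (≤-reflexive (+-comm m 1))))
                  (≤-trans (≤-reflexive (+-comm 1 m)) m+1≤U)

Precedes-cong : ∀ {m a b x y a′ b′ x′ y′} → a ≡ a′ → b ≡ b′ → x ≡ x′ → y ≡ y′ →
  Precedes m a′ b′ x′ y′ → Precedes m a b x y
Precedes-cong refl refl refl refl p = p

predecessor-2/[j+2] : ∀ m s → InRange m 2 (3 + 2 * s + 2) →
  ∀ t d → d ≡ 1 + 2 * t → 2 * s * t + s + 3 * t + 1 < m → m ≤ 2 * s * t + 3 * s + 3 * t + 4 →
  Precedes m d ⌊ (3 + 2 * s + 2) * d + 1 /2⌋ 2 (3 + 2 * s + 2)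
predecessor-2/[j+2] m s x/y t .(1 + 2 * t) refl L<m m≤U =
  Precedes-cong refl (⌊E/2⌋≡n _ b-double) refl refl
    (adjacent-if-mediant-outside det
      (inRange-intro (1 + 2 * t) (2 * s * t + s + 5 * t + 3) L<m
        (n≡m+o⇒m≤n (2 * s * t + s + 5 * t + 2) (solve (s ∷ t ∷ [])))
        (n≡m+o⇒m≤n (2 * s * t + s + 3 * t + 2) (solve (s ∷ t ∷ [])))
        (n≡m+o⇒m≤n (2 * s * t + s + t + 1) (solve (s ∷ t ∷ [])))
        (≤-reflexive (solve (s ∷ t ∷ []))))
      x/y (inj₂ gap))
  where
  b-double : (3 + 2 * s + 2) * (1 + 2 * t) + 1 ≡ (2 * s * t + s + 5 * t + 3) + (2 * s * t + s + 5 * t + 3)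
  b-double = solve (s ∷ t ∷ [])
  det : 2 * (2 * s * t + s + 5 * t + 3) ≡ suc ((1 + 2 * t) * (3 + 2 * s + 2))
  det = solve (s ∷ t ∷ [])
  gap : m + (1 + 2 * t + 2) < (2 * s * t + s + 5 * t + 3) + (3 + 2 * s + 2)
  gap = begin-strict
    m + (1 + 2 * t + 2)                               ≤⟨ +-monoˡ-≤ (1 + 2 * t + 2) m≤U ⟩
    (2 * s * t + 3 * s + 3 * t + 4) + (1 + 2 * t + 2) <⟨ ≤-reflexive (solve (s ∷ t ∷ [])) ⟩
    (2 * s * t + s + 5 * t + 3) + (3 + 2 * s + 2)     ∎
    where open ≤-Reasoning

successor-2/[j+2] : ∀ m s → InRange m 2 (3 + 2 * s + 2) →
  ∀ t d → d ≡ 1 + 2 * t → 2 * s * t + s + 3 * t + 1 ≤ m → m < 2 * s * t + 3 * s + 3 * t + 4 →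
  Succeeds m d ⌊ (3 + 2 * s + 2) * d ∸ 1 /2⌋ 2 (3 + 2 * s + 2)
successor-2/[j+2] m s a/b t .(1 + 2 * t) refl L≤m m<U =
  Precedes-cong refl refl refl (⌊E∸1/2⌋≡n _ y-odd)
    (adjacent-if-mediant-outside det a/b
      (inRange-intro (1 + 2 * t) (2 * s * t + s + 5 * t + 2) L≤m
        (n≡m+o⇒m≤n (2 * s * t + s + 5 * t + 1) (solve (s ∷ t ∷ [])))
        (n≡m+o⇒m≤n (2 * s * t + s + 3 * t + 1) (solve (s ∷ t ∷ [])))
        (n≡m+o⇒m≤n (2 * s * t + s + t) (solve (s ∷ t ∷ [])))
        (≤-reflexive (solve (s ∷ t ∷ []))))
      (inj₂ gap))
  where
  y-odd : (3 + 2 * s + 2) * (1 + 2 * t) ≡ suc ((2 * s * t + s + 5 * t + 2) + (2 * s * t + s + 5 * t + 2))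
  y-odd = solve (s ∷ t ∷ [])
  det : (1 + 2 * t) * (3 + 2 * s + 2) ≡ suc (2 * (2 * s * t + s + 5 * t + 2))
  det = solve (s ∷ t ∷ [])
  gap : m + (2 + (1 + 2 * t)) < (3 + 2 * s + 2) + (2 * s * t + s + 5 * t + 2)
  gap = begin-strict
    m + (2 + (1 + 2 * t))                             <⟨ +-monoˡ-< (2 + (1 + 2 * t)) m<U ⟩
    (2 * s * t + 3 * s + 3 * t + 4) + (2 + (1 + 2 * t)) ≡⟨ solve (s ∷ t ∷ []) ⟩
    (3 + 2 * s + 2) + (2 * s * t + s + 5 * t + 2)     ∎
    where open ≤-Reasoning

predecessor-[j∸2]/2[j∸1] : ∀ m s → InRange m (1 + 2 * s) (2 * (2 + 2 * s)) →
  ∀ t d → d ≡ 1 + 2 * t → 2 * s * t + s + 3 * t + 1 ≤ m → m < 2 * s * t + 3 * s + 3 * t + 4 →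
  Precedes m ⌊ (1 + 2 * s) * d ∸ 1 /2⌋ ((2 + 2 * s) * d ∸ 1) (1 + 2 * s) (2 * (2 + 2 * s))
predecessor-[j∸2]/2[j∸1] m s x/y t .(1 + 2 * t) refl L≤m m<U =
  Precedes-cong (⌊E∸1/2⌋≡n _ a-odd) (cong (_∸ 1) b-suc) refl refl
    (adjacent-if-mediant-outside det
      (inRange-intro (2 * s * t + s + t) (4 * s * t + 2 * s + 4 * t + 1) L≤m
        (n≡m+o⇒m≤n (4 * s * t + 2 * s + 4 * t) (solve (s ∷ t ∷ [])))
        (n≡m+o⇒m≤n (2 * s * t + s + 3 * t + 1) (solve (s ∷ t ∷ [])))
        (n≡m+o⇒m≤n (2 * t + 1) (solve (s ∷ t ∷ [])))
        (≤-reflexive (solve (s ∷ t ∷ []))))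
      x/y (inj₂ gap))
  where
  a-odd : (1 + 2 * s) * (1 + 2 * t) ≡ suc ((2 * s * t + s + t) + (2 * s * t + s + t))
  a-odd = solve (s ∷ t ∷ [])
  b-suc : (2 + 2 * s) * (1 + 2 * t) ≡ suc (4 * s * t + 2 * s + 4 * t + 1)
  b-suc = solve (s ∷ t ∷ [])
  det : (1 + 2 * s) * (4 * s * t + 2 * s + 4 * t + 1) ≡ suc ((2 * s * t + s + t) * (2 * (2 + 2 * s)))
  det = solve (s ∷ t ∷ [])
  gap : m + ((2 * s * t + s + t) + (1 + 2 * s)) < (4 * s * t + 2 * s + 4 * t + 1) + 2 * (2 + 2 * s)
  gap = begin-strict
    m + ((2 * s * t + s + t) + (1 + 2 * s))
      <⟨ +-monoˡ-< ((2 * s * t + s + t) + (1 + 2 * s)) m<U ⟩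
    (2 * s * t + 3 * s + 3 * t + 4) + ((2 * s * t + s + t) + (1 + 2 * s))
      ≡⟨ solve (s ∷ t ∷ []) ⟩
    (4 * s * t + 2 * s + 4 * t + 1) + 2 * (2 + 2 * s) ∎
    where open ≤-Reasoning

successor-[j∸2]/2[j∸1] : ∀ m s → InRange m (1 + 2 * s) (2 * (2 + 2 * s)) →
  ∀ t d → d ≡ 1 + 2 * t → 2 * s * t + s + 3 * t + 1 < m → m ≤ 2 * s * t + 3 * s + 3 * t + 4 →
  Succeeds m ⌊ (1 + 2 * s) * d + 1 /2⌋ ((2 + 2 * s) * d + 1) (1 + 2 * s) (2 * (2 + 2 * s))
successor-[j∸2]/2[j∸1] m s a/b t .(1 + 2 * t) refl L<m m≤U =
  Precedes-cong refl refl (⌊E/2⌋≡n _ x-double) refl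
    (adjacent-if-mediant-outside det a/b
      (inRange-intro (2 * s * t + s + t + 1) ((2 + 2 * s) * (1 + 2 * t) + 1) L<m
        (n≡m+o⇒m≤n (4 * s * t + 2 * s + 4 * t + 2) (solve (s ∷ t ∷ [])))
        (n≡m+o⇒m≤n (2 * s * t + s + 3 * t + 2) (solve (s ∷ t ∷ [])))
        (n≡m+o⇒m≤n (2 * t + 1) (solve (s ∷ t ∷ [])))
        (≤-reflexive (solve (s ∷ t ∷ []))))
      (inj₂ gap))
  where
  x-double : (1 + 2 * s) * (1 + 2 * t) + 1 ≡ (2 * s * t + s + t + 1) + (2 * s * t + s + t + 1)
  x-double = solve (s ∷ t ∷ [])
  det : (2 * s * t + s + t + 1) * (2 * (2 + 2 * s)) ≡ suc ((1 + 2 * s) * ((2 + 2 * s) * (1 + 2 * t) + 1))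
  det = solve (s ∷ t ∷ [])
  gap : m + (1 + 2 * s + (2 * s * t + s + t + 1)) < 2 * (2 + 2 * s) + ((2 + 2 * s) * (1 + 2 * t) + 1)
  gap = begin-strict
    m + (1 + 2 * s + (2 * s * t + s + t + 1))
      ≤⟨ +-monoˡ-≤ (1 + 2 * s + (2 * s * t + s + t + 1)) m≤U ⟩
    (2 * s * t + 3 * s + 3 * t + 4) + (1 + 2 * s + (2 * s * t + s + t + 1))
      <⟨ ≤-reflexive (solve (s ∷ t ∷ [])) ⟩
    2 * (2 + 2 * s) + ((2 + 2 * s) * (1 + 2 * t) + 1) ∎
    where open ≤-Reasoning

predecessor-j/2[j∸1] : ∀ m s → InRange m (3 + 2 * s) (2 * (2 + 2 * s)) →
  ∀ t d → d ≡ 1 + 2 * t → 2 * s * t + s + 3 * t + 1 < m → m ≤ 2 * s * t + 3 * s + 3 * t + 4 →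
  Precedes m ⌊ (3 + 2 * s) * d + 1 /2⌋ ((2 + 2 * s) * d + 1) (3 + 2 * s) (2 * (2 + 2 * s))
predecessor-j/2[j∸1] m s x/y t .(1 + 2 * t) refl L<m m≤U =
  Precedes-cong (⌊E/2⌋≡n _ a-double) refl refl refl
    (adjacent-if-mediant-outside det
      (inRange-intro (2 * s * t + s + 3 * t + 2) ((2 + 2 * s) * (1 + 2 * t) + 1) L<m
        (n≡m+o⇒m≤n (4 * s * t + 2 * s + 4 * t + 2) (solve (s ∷ t ∷ [])))
        (n≡m+o⇒m≤n (2 * s * t + s + t + 1) (solve (s ∷ t ∷ [])))
        (≤-reflexive (solve (s ∷ t ∷ [])))
        (n≡m+o⇒m≤n (2 * t + 1) (solve (s ∷ t ∷ []))))
      x/y (inj₁ excess))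
  where
  a-double : (3 + 2 * s) * (1 + 2 * t) + 1 ≡ (2 * s * t + s + 3 * t + 2) + (2 * s * t + s + 3 * t + 2)
  a-double = solve (s ∷ t ∷ [])
  det : (3 + 2 * s) * ((2 + 2 * s) * (1 + 2 * t) + 1) ≡ suc ((2 * s * t + s + 3 * t + 2) * (2 * (2 + 2 * s)))
  det = solve (s ∷ t ∷ [])
  excess : m < (2 * s * t + s + 3 * t + 2) + (3 + 2 * s)
  excess = begin-strict
    m                               ≤⟨ m≤U ⟩
    2 * s * t + 3 * s + 3 * t + 4   <⟨ ≤-reflexive (solve (s ∷ t ∷ [])) ⟩
    (2 * s * t + s + 3 * t + 2) + (3 + 2 * s) ∎
    where open ≤-Reasoning

successor-j/2[j∸1] : ∀ m s → InRange m (3 + 2 * s) (2 * (2 + 2 * s)) →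
  ∀ t d → d ≡ 1 + 2 * t → 2 * s * t + s + 3 * t + 1 ≤ m → m < 2 * s * t + 3 * s + 3 * t + 4 →
  Succeeds m ⌊ (3 + 2 * s) * d ∸ 1 /2⌋ ((2 + 2 * s) * d ∸ 1) (3 + 2 * s) (2 * (2 + 2 * s))
successor-j/2[j∸1] m s a/b t .(1 + 2 * t) refl L≤m m<U =
  Precedes-cong refl refl (⌊E∸1/2⌋≡n _ x-odd) (cong (_∸ 1) y-suc)
    (adjacent-if-mediant-outside det a/b
      (inRange-intro (2 * s * t + s + 3 * t + 1) (4 * s * t + 2 * s + 4 * t + 1) L≤m
        (n≡m+o⇒m≤n (4 * s * t + 2 * s + 4 * t) (solve (s ∷ t ∷ [])))
        (n≡m+o⇒m≤n (2 * s * t + s + t) (solve (s ∷ t ∷ [])))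
        ≤-refl
        (n≡m+o⇒m≤n (2 * t + 1) (solve (s ∷ t ∷ []))))
      (inj₁ excess))
  where
  x-odd : (3 + 2 * s) * (1 + 2 * t) ≡ suc ((2 * s * t + s + 3 * t + 1) + (2 * s * t + s + 3 * t + 1))
  x-odd = solve (s ∷ t ∷ [])
  y-suc : (2 + 2 * s) * (1 + 2 * t) ≡ suc (4 * s * t + 2 * s + 4 * t + 1)
  y-suc = solve (s ∷ t ∷ [])
  det : (2 * s * t + s + 3 * t + 1) * (2 * (2 + 2 * s)) ≡ suc ((3 + 2 * s) * (4 * s * t + 2 * s + 4 * t + 1))
  det = solve (s ∷ t ∷ [])
  excess : m < 3 + 2 * s + (2 * s * t + s + 3 * t + 1)
  excess = begin-strict
    m                             <⟨ m<U ⟩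
    2 * s * t + 3 * s + 3 * t + 4 ≡⟨ solve (s ∷ t ∷ []) ⟩
    3 + 2 * s + (2 * s * t + s + 3 * t + 1) ∎
    where open ≤-Reasoning

predecessor-j/[j+2] : ∀ m s → InRange m (3 + 2 * s) (3 + 2 * s + 2) →
  ∀ t d → d ≡ 1 + 2 * t → 2 * s * t + s + 3 * t + 1 ≤ m → m < 2 * s * t + 3 * s + 3 * t + 4 →
  Precedes m ⌊ (3 + 2 * s) * d ∸ 1 /2⌋ ⌊ (3 + 2 * s + 2) * d ∸ 1 /2⌋ (3 + 2 * s) (3 + 2 * s + 2)
predecessor-j/[j+2] m s x/y t .(1 + 2 * t) refl L≤m m<U =
  Precedes-cong (⌊E∸1/2⌋≡n _ a-odd) (⌊E∸1/2⌋≡n _ b-odd) refl refl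
    (adjacent-if-mediant-outside det
      (inRange-intro (2 * s * t + s + 3 * t + 1) (2 * s * t + s + 5 * t + 2) L≤m
        (n≡m+o⇒m≤n (2 * s * t + s + 5 * t + 1) (solve (s ∷ t ∷ [])))
        (n≡m+o⇒m≤n (2 * t + 1) (solve (s ∷ t ∷ [])))
        ≤-refl
        (n≡m+o⇒m≤n (2 * s * t + s + t) (solve (s ∷ t ∷ []))))
      x/y (inj₁ excess))
  where
  a-odd : (3 + 2 * s) * (1 + 2 * t) ≡ suc ((2 * s * t + s + 3 * t + 1) + (2 * s * t + s + 3 * t + 1))
  a-odd = solve (s ∷ t ∷ [])
  b-odd : (3 + 2 * s + 2) * (1 + 2 * t) ≡ suc ((2 * s * t + s + 5 * t + 2) + (2 * s * t + s + 5 * t + 2))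
  b-odd = solve (s ∷ t ∷ [])
  det : (3 + 2 * s) * (2 * s * t + s + 5 * t + 2) ≡ suc ((2 * s * t + s + 3 * t + 1) * (3 + 2 * s + 2))
  det = solve (s ∷ t ∷ [])
  excess : m < (2 * s * t + s + 3 * t + 1) + (3 + 2 * s)
  excess = begin-strict
    m                             <⟨ m<U ⟩
    2 * s * t + 3 * s + 3 * t + 4 ≡⟨ solve (s ∷ t ∷ []) ⟩
    (2 * s * t + s + 3 * t + 1) + (3 + 2 * s) ∎
    where open ≤-Reasoning

successor-j/[j+2] : ∀ m s → InRange m (3 + 2 * s) (3 + 2 * s + 2) →
  ∀ t d → d ≡ 1 + 2 * t → 2 * s * t + s + 3 * t + 1 < m → m ≤ 2 * s * t + 3 * s + 3 * t + 4 →
  Succeeds m ⌊ (3 + 2 * s) * d + 1 /2⌋ ⌊ (3 + 2 * s + 2) * d + 1 /2⌋ (3 + 2 * s) (3 + 2 * s + 2)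
successor-j/[j+2] m s a/b t .(1 + 2 * t) refl L<m m≤U =
  Precedes-cong refl refl (⌊E/2⌋≡n _ x-double) (⌊E/2⌋≡n _ y-double)
    (adjacent-if-mediant-outside det a/b
      (inRange-intro (2 * s * t + s + 3 * t + 2) (2 * s * t + s + 5 * t + 3) L<m
        (n≡m+o⇒m≤n (2 * s * t + s + 5 * t + 2) (solve (s ∷ t ∷ [])))
        (n≡m+o⇒m≤n (2 * t + 1) (solve (s ∷ t ∷ [])))
        (≤-reflexive (solve (s ∷ t ∷ [])))
        (n≡m+o⇒m≤n (2 * s * t + s + t + 1) (solve (s ∷ t ∷ []))))
      (inj₁ excess))
  where
  x-double : (3 + 2 * s) * (1 + 2 * t) + 1 ≡ (2 * s * t + s + 3 * t + 2) + (2 * s * t + s + 3 * t + 2)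
  x-double = solve (s ∷ t ∷ [])
  y-double : (3 + 2 * s + 2) * (1 + 2 * t) + 1 ≡ (2 * s * t + s + 5 * t + 3) + (2 * s * t + s + 5 * t + 3)
  y-double = solve (s ∷ t ∷ [])
  det : (2 * s * t + s + 3 * t + 2) * (3 + 2 * s + 2) ≡ suc ((3 + 2 * s) * (2 * s * t + s + 5 * t + 3))
  det = solve (s ∷ t ∷ [])
  excess : m < 3 + 2 * s + (2 * s * t + s + 3 * t + 2)
  excess = begin-strict
    m                               ≤⟨ m≤U ⟩
    2 * s * t + 3 * s + 3 * t + 4   <⟨ ≤-reflexive (solve (s ∷ t ∷ [])) ⟩
    3 + 2 * s + (2 * s * t + s + 3 * t + 2) ∎
    where open ≤-Reasoning

coprime⇒¬2∣both : ∀ {h k} → Coprime h k → 2 ∣ h → ¬ 2 ∣ k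
coprime⇒¬2∣both cop 2∣h 2∣k = contradiction (cop (2∣h , 2∣k)) λ ()

2∣n⇒2∣n∸2 : ∀ {n} → 2 ∣ n → 2 ∣ n ∸ 2
2∣n⇒2∣n∸2 (divides-refl q) = divides (q ∸ 1) (sym (*-distribʳ-∸ 2 q 1))

neighbours-2/[j+2] : ∀ m j .{{_ : NonZero j}} → InF m 2 (j + 2) × FLess 2 (j + 2) 1 2 →
  ByParity ⌈ 2 * m / j ⌉ (λ d → Precedes m d ⌊ (j + 2) * d + 1 /2⌋ 2 (j + 2)) ×
  ByParity ⌈ 2 * (m + 1) / j ⌉ (λ d → Succeeds m d ⌊ (j + 2) * d ∸ 1 /2⌋ 2 (j + 2))
neighbours-2/[j+2] m j ((cop , x/y@(_ , _ , _ , j+2≤m+2 , _)) , x/y<1/2)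
  with s , refl ← odd⇒3+2* {j} (λ { refl → from-no (4 <? 3) x/y<1/2 })
                                (λ 2∣j → coprime⇒¬2∣both cop ∣-refl (∣m∣n⇒∣m+n 2∣j ∣-refl)) =
  byParity-⌈2m/j⌉ m s (predecessor-2/[j+2] m s x/y) j≤m ,
  byParity-⌈2[m+1]/j⌉ m s (successor-2/[j+2] m s x/y) j≤m
  where
  j≤m : 3 + 2 * s ≤ m
  j≤m = +-cancelʳ-≤ 2 (3 + 2 * s) m j+2≤m+2

neighbours-[j∸2]/2[j∸1] : ∀ m j .{{_ : NonZero j}} →
  InF m (j ∸ 2) (2 * (j ∸ 1)) × FLess (j ∸ 2) (2 * (j ∸ 1)) 1 2 →
  ByParity ⌈ 2 * (m + 1) / j ⌉
    (λ d → Precedes m ⌊ (j ∸ 2) * d ∸ 1 /2⌋ ((j ∸ 1) * d ∸ 1) (j ∸ 2) (2 * (j ∸ 1))) ×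
  ByParity ⌈ 2 * m / j ⌉
    (λ d → Succeeds m ⌊ (j ∸ 2) * d + 1 /2⌋ ((j ∸ 1) * d + 1) (j ∸ 2) (2 * (j ∸ 1)))
neighbours-[j∸2]/2[j∸1] m j ((cop , x/y@(_ , 1≤k , _ , k≤m+h , _)) , _)
  with s , refl ← odd⇒3+2* {j} (λ { refl → contradiction 1≤k λ () })
                                (λ 2∣j → coprime⇒¬2∣both cop (2∣n⇒2∣n∸2 2∣j) (m∣m*n (j ∸ 1))) =
  byParity-⌈2[m+1]/j⌉ m s (predecessor-[j∸2]/2[j∸1] m s x/y) j≤m ,
  byParity-⌈2m/j⌉ m s (successor-[j∸2]/2[j∸1] m s x/y) j≤m
  where
  j+[j∸2]≡2[j∸1] : 3 + 2 * s + (1 + 2 * s) ≡ 2 * (2 + 2 * s)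
  j+[j∸2]≡2[j∸1] = solve (s ∷ [])
  j≤m : 3 + 2 * s ≤ m
  j≤m = +-cancelʳ-≤ (1 + 2 * s) (3 + 2 * s) m (≤-trans (≤-reflexive j+[j∸2]≡2[j∸1]) k≤m+h)

neighbours-j/2[j∸1] : ∀ m j .{{_ : NonZero j}} →
  InF m j (2 * (j ∸ 1)) × FLess 1 2 j (2 * (j ∸ 1)) →
  ByParity ⌈ 2 * m / j ⌉
    (λ d → Precedes m ⌊ j * d + 1 /2⌋ ((j ∸ 1) * d + 1) j (2 * (j ∸ 1))) ×
  ByParity ⌈ 2 * (m + 1) / j ⌉
    (λ d → Succeeds m ⌊ j * d ∸ 1 /2⌋ ((j ∸ 1) * d ∸ 1) j (2 * (j ∸ 1)))
neighbours-j/2[j∸1] m j ((cop , x/y@(_ , 1≤k , _ , _ , j≤m)) , _)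
  with s , refl ← odd⇒3+2* {j} (λ { refl → contradiction 1≤k λ () })
                                (λ 2∣j → coprime⇒¬2∣both cop 2∣j (m∣m*n (j ∸ 1))) =
  byParity-⌈2m/j⌉ m s (predecessor-j/2[j∸1] m s x/y) j≤m ,
  byParity-⌈2[m+1]/j⌉ m s (successor-j/2[j∸1] m s x/y) j≤m

neighbours-j/[j+2] : ∀ m j .{{_ : NonZero j}} →
  InF m j (j + 2) × FLess 1 2 j (j + 2) →
  ByParity ⌈ 2 * (m + 1) / j ⌉
    (λ d → Precedes m ⌊ j * d ∸ 1 /2⌋ ⌊ (j + 2) * d ∸ 1 /2⌋ j (j + 2)) ×
  ByParity ⌈ 2 * m / j ⌉
    (λ d → Succeeds m ⌊ j * d + 1 /2⌋ ⌊ (j + 2) * d + 1 /2⌋ j (j + 2))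
neighbours-j/[j+2] m j ((cop , x/y@(_ , _ , _ , _ , j≤m)) , 1/2<x/y)
  with s , refl ← odd⇒3+2* {j} (λ { refl → from-no (3 <? 2) 1/2<x/y })
                                (λ 2∣j → coprime⇒¬2∣both cop 2∣j (∣m∣n⇒∣m+n 2∣j ∣-refl)) =
  byParity-⌈2[m+1]/j⌉ m s (predecessor-j/[j+2] m s x/y) j≤m ,
  byParity-⌈2m/j⌉ m s (successor-j/[j+2] m s x/y) j≤m

corollary4p3 : (m j : ℕ) → 1 < m → .{{_ : NonZero j}} →
    -- (i)
    ((InF m 2 (j + 2) × FLess 2 (j + 2) 1 2) →
      ByParity ⌈ 2 * m / j ⌉
        (λ d → Precedes m d ⌊ (j + 2) * d + 1 /2⌋ 2 (j + 2)) ×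
      ByParity ⌈ 2 * (m + 1) / j ⌉
        (λ d → Succeeds m d ⌊ (j + 2) * d ∸ 1 /2⌋ 2 (j + 2))) ×
    -- (ii)
    ((InF m (j ∸ 2) (2 * (j ∸ 1)) × FLess (j ∸ 2) (2 * (j ∸ 1)) 1 2) →
      ByParity ⌈ 2 * (m + 1) / j ⌉
        (λ d → Precedes m ⌊ (j ∸ 2) * d ∸ 1 /2⌋ ((j ∸ 1) * d ∸ 1) (j ∸ 2) (2 * (j ∸ 1))) ×
      ByParity ⌈ 2 * m / j ⌉
        (λ d → Succeeds m ⌊ (j ∸ 2) * d + 1 /2⌋ ((j ∸ 1) * d + 1) (j ∸ 2) (2 * (j ∸ 1)))) ×
    -- (iii)
    ((InF m j (2 * (j ∸ 1)) × FLess 1 2 j (2 * (j ∸ 1))) →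
      ByParity ⌈ 2 * m / j ⌉
        (λ d → Precedes m ⌊ j * d + 1 /2⌋ ((j ∸ 1) * d + 1) j (2 * (j ∸ 1))) ×
      ByParity ⌈ 2 * (m + 1) / j ⌉
        (λ d → Succeeds m ⌊ j * d ∸ 1 /2⌋ ((j ∸ 1) * d ∸ 1) j (2 * (j ∸ 1)))) ×
    -- (iv)
    ((InF m j (j + 2) × FLess 1 2 j (j + 2)) →
      ByParity ⌈ 2 * (m + 1) / j ⌉
        (λ d → Precedes m ⌊ j * d ∸ 1 /2⌋ ⌊ (j + 2) * d ∸ 1 /2⌋ j (j + 2)) ×
      ByParity ⌈ 2 * m / j ⌉
        (λ d → Succeeds m ⌊ j * d + 1 /2⌋ ⌊ (j + 2) * d + 1 /2⌋ j (j + 2)))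
corollary4p3 m j _ =
  neighbours-2/[j+2] m j , neighbours-[j∸2]/2[j∸1] m j , neighbours-j/2[j∸1] m j , neighbours-j/[j+2] m j
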